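{- For every $n\ge0$ and every choice of $R_1,\dots,R_n\in\{\widetilde{U},\widetilde{V}\}$, with $(\alpha_n,\beta_n)=R_n\circ\cdots\circ R_1(a,ab)$ (applying $R_1$ first), the word $(\beta_n^T)^3\alpha_n^T$ is not a prefix of $(\beta_n^T)^4\alpha_n^T$, and the word $(\alpha_n\beta_n^2)(\alpha_n\beta_n^3)^2$ is not a prefix of $(\alpha_n\beta_n^3)(\alpha_n\beta_n^4)^2$.
   Context: Words are over $\{a,b\}$ (identified with words over $\{1,2\}$ via $a\mapsto22$, $b\mapsto11$); $w^T$ is the reversal of $w$ and powers denote repeated concatenation. $\widetilde{U}(\alpha,\beta)=(\alpha\beta^2,\alpha\beta^3)$ and $\widetilde{V}(\alpha,\beta)=(\alpha\beta^3,\alpha\beta^4)$. -}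

module Defs where

open import Data.Nat using (ℕ; zero; suc)
open import Data.List using (List; []; _∷_; _++_; reverse; foldl)
open import Data.Product using (_×_; _,_; ∃)
open import Relation.Binary.PropositionalEquality using (_≡_)

data Letter : Set where
  a b : Letter

Word : Set
Word = List Letter

_^_ : Word → ℕ → Word
w ^ zero  = []
w ^ suc k = w ++ (w ^ k)

_ᵀ : Word → Word
w ᵀ = reverse w

IsPrefix : Word → Word → Set
IsPrefix u w = ∃ λ v → u ++ v ≡ w

Ũ : Word × Word → Word × Word
Ũ (α , β) = (α ++ (β ^ 2) , α ++ (β ^ 3))

Ṽ : Word × Word → Word × Word
Ṽ (α , β) = (α ++ (β ^ 3) , α ++ (β ^ 4))

data Choice : Set where
  U V : Choice

apply : Choice → Word × Word → Word × Word
apply U = Ũ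
apply V = Ṽ

-- iterate [R₁, …, Rₙ] p = Rₙ ∘ ⋯ ∘ R₁ (p)   (R₁ applied first)
iterate : List Choice → Word × Word → Word × Word
iterate Rs p = foldl (λ q R → apply R q) p Rs

start : Word × Word
start = (a ∷ [] , a ∷ b ∷ [])

-- A pair (α , β) is called bad when αβ ends with α.  The morphisms Ũ and Ṽ
-- reflect badness: from (αβᵏ)(αβᵏ⁺¹) ending with αβᵏ one cancels the common
-- suffix βᵏ and is left with α as a suffix of αβᵏαβ, hence of αβ.  The pair
-- (a , ab) is not bad, so no reachable pair is.  Each prefix relation of the
-- theorem would make (α , β) bad: the first, after cancelling (βᵀ)³ and
-- reversing, says exactly that αβ ends with α; the second, after cancelling
-- αβ², forces αβ = βα by comparing prefixes of length |αβ|.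
module Submission where

open import Defs
open import Data.Nat using (zero; suc; pred; _≤_; s≤s)
open import Data.Nat.Properties using (<⇒≱)
open import Data.List using (List; []; _∷_; _++_; length; reverse)
open import Data.List.Properties
  using (++-assoc; ++-identityʳ; ++-cancelˡ; ++-cancelʳ; ++-monoid; ∷-injective; ∷-injectiveʳ;
         ∷ʳ-injectiveʳ; length-++-≤ˡ; length-++-≤ʳ; length-++-comm;
         reverse-++; reverse-involutive)
open import Data.Product using (_×_; _,_; ∃)
open import Relation.Binary.PropositionalEquality
  using (_≡_; refl; sym; cong; cong₂; subst; module ≡-Reasoning)
open import Relation.Nullary using (¬_; contradiction)
open import Tactic.MonoidSolver using (solve)

open ≡-Reasoning

module _ {ℓ} {A : Set ℓ} where

  _IsSuffixOf_ : List A → List A → Set ℓ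
  s IsSuffixOf w = ∃ λ z → z ++ s ≡ w

  suffix-of-longer : ∀ z x w y → z ++ x ≡ w ++ y → length x ≤ length y →
                     x IsSuffixOf y
  suffix-of-longer z       x []      y eq _  = z , eq
  suffix-of-longer []      x (_ ∷ w) y eq le =
    contradiction (subst (λ t → length t ≤ length y) eq le) (<⇒≱ (s≤s (length-++-≤ʳ y {w})))
  suffix-of-longer (_ ∷ z) x (_ ∷ w) y eq le =
    suffix-of-longer z x w y (∷-injectiveʳ eq) le

  ++-prefixes-by-length : ∀ {xs ys r s : List A} → length xs ≡ length ys →
                          xs ++ r ≡ ys ++ s → xs ≡ ys
  ++-prefixes-by-length {[]}     {[]}     _   _  = refl
  ++-prefixes-by-length {x ∷ xs} {y ∷ ys} len eq with refl , eq′ ← ∷-injective eq =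
    cong (x ∷_) (++-prefixes-by-length (cong pred len) eq′)

  suffix-of-shifted : ∀ α β γ → (α ++ γ) IsSuffixOf ((α ++ γ) ++ (α ++ β ++ γ)) →
                      α IsSuffixOf (α ++ β)
  suffix-of-shifted α β γ (z , eq) =
    suffix-of-longer z α (α ++ γ) (α ++ β) (++-cancelʳ γ _ _ shifted) (length-++-≤ˡ α)
    where
    shifted : (z ++ α) ++ γ ≡ ((α ++ γ) ++ (α ++ β)) ++ γ
    shifted = begin
      (z ++ α) ++ γ                   ≡⟨ ++-assoc z α γ ⟩
      z ++ α ++ γ                     ≡⟨ eq ⟩
      (α ++ γ) ++ (α ++ β ++ γ)       ≡⟨ solve (++-monoid A) ⟩
      ((α ++ γ) ++ (α ++ β)) ++ γ     ∎

  reversed-overlap : ∀ x y v → reverse x ++ v ≡ reverse y ++ reverse x →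
                     x IsSuffixOf (x ++ y)
  reversed-overlap x y v eq = reverse v , (begin
    reverse v ++ x                             ≡⟨ cong (reverse v ++_) (reverse-involutive x) ⟨
    reverse v ++ reverse (reverse x)           ≡⟨ reverse-++ (reverse x) v ⟨
    reverse (reverse x ++ v)                   ≡⟨ cong reverse eq ⟩
    reverse (reverse y ++ reverse x)           ≡⟨ reverse-++ (reverse y) (reverse x) ⟩
    reverse (reverse x) ++ reverse (reverse y) ≡⟨ cong₂ _++_ (reverse-involutive x) (reverse-involutive y) ⟩
    x ++ y                                     ∎)

^-suc′ : ∀ (w : Word) n → w ^ suc n ≡ (w ^ n) ++ w
^-suc′ w zero    = ++-identityʳ w
^-suc′ w (suc n) = begin
  w ++ w ^ suc n     ≡⟨ cong (w ++_) (^-suc′ w n) ⟩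
  w ++ (w ^ n ++ w)  ≡⟨ ++-assoc w (w ^ n) w ⟨
  (w ++ w ^ n) ++ w  ∎

cancel-power-prefix : ∀ (w x v : Word) n → ((w ^ n) ++ x) ++ v ≡ (w ^ suc n) ++ x →
                      x ++ v ≡ w ++ x
cancel-power-prefix w x v n eq = ++-cancelˡ (w ^ n) _ _ (begin
  w ^ n ++ x ++ v      ≡⟨ ++-assoc (w ^ n) x v ⟨
  (w ^ n ++ x) ++ v    ≡⟨ eq ⟩
  w ^ suc n ++ x       ≡⟨ cong (_++ x) (^-suc′ w n) ⟩
  (w ^ n ++ w) ++ x    ≡⟨ ++-assoc (w ^ n) w x ⟩
  w ^ n ++ w ++ x      ∎)

Bad : Word × Word → Set
Bad (α , β) = α IsSuffixOf (α ++ β)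

Bad-apply⁻¹ : ∀ R p → Bad (apply R p) → Bad p
Bad-apply⁻¹ U (α , β) = suffix-of-shifted α β (β ^ 2)
Bad-apply⁻¹ V (α , β) = suffix-of-shifted α β (β ^ 3)

Bad-iterate⁻¹ : ∀ Rs p → Bad (iterate Rs p) → Bad p
Bad-iterate⁻¹ []       p bad = bad
Bad-iterate⁻¹ (R ∷ Rs) p bad = Bad-apply⁻¹ R p (Bad-iterate⁻¹ Rs (apply R p) bad)

¬Bad-start : ¬ Bad start
¬Bad-start (z , eq) with () ← ∷ʳ-injectiveʳ z (a ∷ a ∷ []) eq

reversed-prefix⇒Bad : ∀ α β v →
  (((β ᵀ) ^ 3) ++ (α ᵀ)) ++ v ≡ ((β ᵀ) ^ 4) ++ (α ᵀ) → Bad (α , β)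
reversed-prefix⇒Bad α β v eq = reversed-overlap α β v (cancel-power-prefix (β ᵀ) (α ᵀ) v 3 eq)

prefix⇒commute : ∀ α β v →
  ((α ++ (β ^ 2)) ++ ((α ++ (β ^ 3)) ^ 2)) ++ v ≡ (α ++ (β ^ 3)) ++ ((α ++ (β ^ 4)) ^ 2) →
  α ++ β ≡ β ++ α
prefix⇒commute α β v eq =
  ++-prefixes-by-length (length-++-comm α β) (++-cancelˡ (α ++ β ++ β) _ _ (begin
    (α ++ β ++ β) ++ (α ++ β) ++ r₁                                ≡⟨ solve (++-monoid Letter) ⟩
    ((α ++ (β ^ 2)) ++ ((α ++ (β ^ 3)) ^ 2)) ++ v                 ≡⟨ eq ⟩
    (α ++ (β ^ 3)) ++ ((α ++ (β ^ 4)) ^ 2)                        ≡⟨ solve (++-monoid Letter) ⟩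
    (α ++ β ++ β) ++ (β ++ α) ++ r₂                                ∎))
  where
  r₁ r₂ : Word
  r₁ = β ++ β ++ (α ++ (β ^ 3)) ++ v
  r₂ = (β ^ 4) ++ α ++ (β ^ 4)

lemma3p1 : (Rs : List Choice) → (α β : Word) → iterate Rs start ≡ (α , β) →
    ¬ IsPrefix (((β ᵀ) ^ 3) ++ (α ᵀ)) (((β ᵀ) ^ 4) ++ (α ᵀ))
    × ¬ IsPrefix ((α ++ (β ^ 2)) ++ ((α ++ (β ^ 3)) ^ 2)) ((α ++ (β ^ 3)) ++ ((α ++ (β ^ 4)) ^ 2))
lemma3p1 Rs α β reached =
    (λ (v , eq) → ¬Bad (reversed-prefix⇒Bad α β v eq))
  , (λ (v , eq) → ¬Bad (β , sym (prefix⇒commute α β v eq)))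
  where
  ¬Bad : ¬ Bad (α , β)
  ¬Bad bad = ¬Bad-start (Bad-iterate⁻¹ Rs start (subst Bad (sym reached) bad))
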